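{- Let $\Gamma$ be a bipartite $(d,3,-4)$-graph with $d\ge4$. There is no edge in $\Gamma$ joining a branch vertex of $\Gamma_2$ to a vertex of $\Gamma_1$.
   Context: All graphs are simple. The bipartite Moore bound is $\mathcal{M}^b(d,D)=2(1+(d-1)+\dots+(d-1)^{D-1})$; a bipartite $(d,D,-\epsilon)$-graph is a bipartite graph of maximum degree $d$, diameter $D$ and order $\mathcal{M}^b(d,D)-\epsilon$. In a bipartite $(d,3,-4)$-graph $\Gamma$, a short cycle is a cycle of length at most $4$; two distinct short cycles are neighbors if they share a vertex. $S_2(\Gamma)$ (resp. $S_1(\Gamma)$) is the set of short cycles whose intersections with their neighbor cycles are paths of length $2$ (resp. $1$), and $\Gamma_i$ is the subgraph formed by the union of all cycles in $S_i(\Gamma)$. Each connected component of $\Gamma_2$ is isomorphic to $\Theta_2$, the union of three internally disjoint paths of length $2$ with common endvertices; a branch vertex of $\Gamma_2$ is one of these two common endvertices (degree $3$ in $\Gamma_2$). -}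

module Defs where

open import Data.Nat using (ℕ; zero; suc; _+_; _*_; _∸_; _^_; _≤_)
open import Data.Fin using (Fin)
open import Data.Bool using (Bool; T)
open import Data.List using (List; length; filterᵇ; allFin)
open import Data.Product using (Σ; ∃; ∃-syntax; _×_; _,_)
open import Data.Sum using (_⊎_)
open import Relation.Nullary using (¬_)
open import Relation.Binary.PropositionalEquality using (_≡_; _≢_)
open import Function.Bundles using (_⇔_)

record Graph : Set where
  field
    n     : ℕ
    adj   : Fin n → Fin n → Bool
    sym   : ∀ u v → T (adj u v) → T (adj v u)
    irrefl : ∀ v → ¬ T (adj v v)

module _ (G : Graph) where
  open Graph G

  Edge : Fin n → Fin n → Set
  Edge u v = T (adj u v)

  degree : Fin n → ℕ
  degree v = length (filterᵇ (adj v) (allFin n))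

  MaxDegree : ℕ → Set
  MaxDegree d = (∀ v → degree v ≤ d) × (∃[ v ] degree v ≡ d)

  data Walk : Fin n → Fin n → ℕ → Set where
    nil  : ∀ {u} → Walk u u 0
    cons : ∀ {u w v k} → Edge u w → Walk w v k → Walk u v (suc k)

  DistLe : Fin n → Fin n → ℕ → Set
  DistLe u v k = ∃[ m ] (m ≤ k × Walk u v m)

  Diameter : ℕ → Set
  Diameter D = (∀ u v → DistLe u v D)
             × (∃[ u ] ∃[ v ] (∀ m → Walk u v m → D ≤ m))

  Bipartite : Set
  Bipartite = Σ (Fin n → Bool) λ c → ∀ u v → Edge u v → c u ≢ c v

  -- Short cycles: cycles of length at most 4 (in a simple graph these
  -- are the cycles of length 3 or 4), given by a cyclic vertex sequence.

  data ShortCycle : Set where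
    tri : (a b c : Fin n) → a ≢ b → b ≢ c → a ≢ c →
          Edge a b → Edge b c → Edge c a → ShortCycle
    sq  : (a b c e : Fin n) → a ≢ b → a ≢ c → a ≢ e → b ≢ c → b ≢ e → c ≢ e →
          Edge a b → Edge b c → Edge c e → Edge e a → ShortCycle

  UPair : Fin n → Fin n → Fin n → Fin n → Set
  UPair u v x y = (u ≡ x × v ≡ y) ⊎ (u ≡ y × v ≡ x)

  OnCycle : ShortCycle → Fin n → Set
  OnCycle (tri a b c _ _ _ _ _ _) v = v ≡ a ⊎ v ≡ b ⊎ v ≡ c
  OnCycle (sq a b c e _ _ _ _ _ _ _ _ _ _) v = v ≡ a ⊎ v ≡ b ⊎ v ≡ c ⊎ v ≡ e

  EdgeOfCycle : ShortCycle → Fin n → Fin n → Set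
  EdgeOfCycle (tri a b c _ _ _ _ _ _) u v = UPair u v a b ⊎ UPair u v b c ⊎ UPair u v c a
  EdgeOfCycle (sq a b c e _ _ _ _ _ _ _ _ _ _) u v =
    UPair u v a b ⊎ UPair u v b c ⊎ UPair u v c e ⊎ UPair u v e a

  -- two cycles are the same (as subgraphs) iff they have the same edge set
  SameCycle : ShortCycle → ShortCycle → Set
  SameCycle C C' = ∀ u v → EdgeOfCycle C u v ⇔ EdgeOfCycle C' u v

  Neighbours : ShortCycle → ShortCycle → Set
  Neighbours C C' = ¬ SameCycle C C' × ∃[ v ] (OnCycle C v × OnCycle C' v)

  MeetInPath1 : ShortCycle → ShortCycle → Set
  MeetInPath1 C C' = ∃[ x ] ∃[ y ] (x ≢ y
    × (∀ v → (OnCycle C v × OnCycle C' v) ⇔ (v ≡ x ⊎ v ≡ y))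
    × (∀ u v → (EdgeOfCycle C u v × EdgeOfCycle C' u v) ⇔ UPair u v x y))

  MeetInPath2 : ShortCycle → ShortCycle → Set
  MeetInPath2 C C' = ∃[ x ] ∃[ y ] ∃[ z ] (x ≢ y × y ≢ z × x ≢ z
    × (∀ v → (OnCycle C v × OnCycle C' v) ⇔ (v ≡ x ⊎ v ≡ y ⊎ v ≡ z))
    × (∀ u v → (EdgeOfCycle C u v × EdgeOfCycle C' u v) ⇔ (UPair u v x y ⊎ UPair u v y z)))

  InS1 : ShortCycle → Set
  InS1 C = (∃[ C' ] Neighbours C C') × (∀ C' → Neighbours C C' → MeetInPath1 C C')

  InS2 : ShortCycle → Set
  InS2 C = (∃[ C' ] Neighbours C C') × (∀ C' → Neighbours C C' → MeetInPath2 C C')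

  VertexOfΓ1 : Fin n → Set
  VertexOfΓ1 v = ∃[ C ] (InS1 C × OnCycle C v)

  EdgeOfΓ2 : Fin n → Fin n → Set
  EdgeOfΓ2 u v = ∃[ C ] (InS2 C × EdgeOfCycle C u v)

  BranchVertexΓ2 : Fin n → Set
  BranchVertexΓ2 v = ∃[ u₁ ] ∃[ u₂ ] ∃[ u₃ ] (u₁ ≢ u₂ × u₁ ≢ u₃ × u₂ ≢ u₃
    × EdgeOfΓ2 v u₁ × EdgeOfΓ2 v u₂ × EdgeOfΓ2 v u₃
    × (∀ w → EdgeOfΓ2 v w → w ≡ u₁ ⊎ w ≡ u₂ ⊎ w ≡ u₃))

-- Bipartite Moore bound  M^b(d,D) = 2 (1 + (d-1) + ... + (d-1)^(D-1))

geomSum : ℕ → ℕ → ℕ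
geomSum r zero    = 0
geomSum r (suc k) = geomSum r k + r ^ k

MooreBip : ℕ → ℕ → ℕ
MooreBip d D = 2 * geomSum (d ∸ 1) D

BipartiteDDε : Graph → ℕ → ℕ → ℕ → Set
BipartiteDDε G d D ε = Bipartite G × MaxDegree G d × Diameter G D
                     × Graph.n G + ε ≡ MooreBip d D

-- Write d = e + 1, let cm x z be the number of common neighbours of x and z,
-- and call Ex x = Σ_{z ≠ x} (cm x z − 1) the excess of x. Counting the paths
-- of length 2 from x (diameter 3 makes every other vertex of x's colour class
-- the end of one) bounds the size of that class plus Ex x by 1 + e·d. Since
-- the order is the Moore bound minus 4, two vertices of opposite colours with
-- excess ≥ 2 force the graph to be d-regular with all excesses ≤ 2
-- (PathCounting.regular); a theta graph supplies such vertices (a tip and a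
-- middle). Excess ≤ 2 forbids the patterns (4), (3,2) and (2,2,2) of common
-- neighbours at a vertex (SmallExcess). Hence a middle of a theta graph has
-- Γ₂-degree ≤ 2 and lies on no cycle of S₁ (SmallExcess.Middle), and, by a
-- further count, a tip has no neighbour on a cycle of S₁
-- (RegularSmallExcess.Tip). As every branch vertex of Γ₂ lies on a theta
-- graph (ThetaFacts.theta-at-branch), the theorem follows (Defect4Graph).
module Submission where

open import Defs
open import Data.Nat using (ℕ; zero; suc; _+_; _*_; _∸_; _≤_; z≤n; s≤s)
open import Data.Nat.Properties
  using (≤-refl; ≤-reflexive; ≤-trans; ≤-antisym; ≤-pred; ≰⇒>; _≤?_; 1+n≰n; m≤m+n; m≤n⇒m≤n+o; m∸n≤m;
         m+[n∸m]≡n; ∸-monoˡ-≤; +-comm; +-suc; +-identityʳ; +-mono-≤; +-monoʳ-≤;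
         +-cancelˡ-≤; +-cancelʳ-≤; *-suc; *-zeroʳ; *-identityʳ; *-monoˡ-≤; *-monoʳ-≤;
         +-*-semiring; *-commutativeSemigroup; module ≤-Reasoning)
open import Data.Nat.Solver using (module +-*-Solver)
open import Data.Fin using (Fin; zero; suc)
open import Data.Fin.Properties using (_≟_; suc-injective; any?)
open import Data.Bool using (Bool; true; false; if_then_else_)
import Data.Bool.Properties as Bool
open import Data.Bool.Properties using (¬-not; T-≡)
open import Data.List using (length; filterᵇ; tabulate)
open import Data.Vec as Vec using (Vec; []; _∷_)
open import Data.Vec.Relation.Unary.All as All using (All; []; _∷_)
import Data.Vec.Relation.Unary.All.Properties as Allₚ
open import Data.Vec.Relation.Unary.AllPairs as AllPairs using (AllPairs; []; _∷_)
import Data.Vec.Relation.Unary.AllPairs.Properties as AllPairsₚ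
open import Data.Product using (Σ; ∃-syntax; _×_; _,_; proj₁; proj₂)
open import Data.Sum using (_⊎_; inj₁; inj₂)
open import Data.Empty using (⊥; ⊥-elim)
open import Data.Unit using (tt)
open import Function using (_∘_; id)
open import Function.Bundles using (Equivalence)
open import Relation.Nullary using (¬_; does; yes; no)
open import Relation.Nullary.Decidable using (dec-true; dec-false)
open import Relation.Binary.PropositionalEquality
open import Algebra.Properties.Semiring.Sum +-*-semiring
  using (sum; sum-cong-≗; ∑-distrib-+; ∑-comm; *-distribˡ-sum; *-distribʳ-sum)
open import Algebra.Properties.CommutativeSemigroup *-commutativeSemigroup using (x∙yz≈y∙xz)

bit : Bool → ℕ
bit true  = 1
bit false = 0

bit≤1 : ∀ b → bit b ≤ 1
bit≤1 true  = s≤s z≤n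
bit≤1 false = z≤n

Distinct : ∀ {k m} → Vec (Fin k) m → Set
Distinct = AllPairs _≢_

sum-mono : ∀ {k} {f g : Fin k → ℕ} → (∀ i → f i ≤ g i) → sum f ≤ sum g
sum-mono {zero}  f≤g = z≤n
sum-mono {suc k} f≤g = +-mono-≤ (f≤g zero) (sum-mono (f≤g ∘ suc))

sum-ones : ∀ {k} → sum {k} (λ _ → 1) ≡ k
sum-ones {zero}  = refl
sum-ones {suc k} = cong suc (sum-ones {k})

point : ∀ {k} → Fin k → ℕ → Fin k → ℕ
point j c i = if does (i ≟ j) then c else 0

sum-zero : ∀ {k} → sum {k} (λ _ → 0) ≡ 0
sum-zero {zero}  = refl
sum-zero {suc k} = sum-zero {k}

sum-point : ∀ {k} (j : Fin k) (c : ℕ) → sum (point j c) ≡ c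
sum-point {suc k} zero    c = trans (cong (c +_) (sum-zero {k})) (+-identityʳ c)
sum-point {suc k} (suc j) c = sum-point j c

erase : ∀ {k} → Fin k → (Fin k → ℕ) → Fin k → ℕ
erase j h i = if does (i ≟ j) then 0 else h i

erase-other : ∀ {k} (h : Fin k → ℕ) {i j : Fin k} → i ≢ j → erase j h i ≡ h i
erase-other h {i} {j} i≢j rewrite dec-false (i ≟ j) i≢j = refl

erase-positive : ∀ {k} {h : Fin k → ℕ} {i j} → 1 ≤ erase j h i → i ≢ j × 1 ≤ h i
erase-positive {i = i} {j} p with i ≟ j
... | yes _   = ⊥-elim (1+n≰n p)
... | no  i≢j = i≢j , p

sum-erase : ∀ {k} (h : Fin k → ℕ) (j : Fin k) → sum h ≡ h j + sum (erase j h)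
sum-erase h j = begin
  sum h                                      ≡⟨ sum-cong-≗ decompose ⟩
  sum (λ i → point j (h j) i + erase j h i)  ≡⟨ ∑-distrib-+ (point j (h j)) (erase j h) ⟩
  sum (point j (h j)) + sum (erase j h)      ≡⟨ cong (_+ sum (erase j h)) (sum-point j (h j)) ⟩
  h j + sum (erase j h)                      ∎
  where
  open ≡-Reasoning
  decompose : ∀ i → h i ≡ point j (h j) i + erase j h i
  decompose i with i ≟ j
  ... | yes refl = sym (+-identityʳ (h i))
  ... | no  _    = refl

sum-erase-one : ∀ {k} (h : Fin k → ℕ) {j} → h j ≡ 1 → sum h ≡ suc (sum (erase j h))
sum-erase-one h {j} hj≡1 = trans (sum-erase h j) (cong (_+ sum (erase j h)) hj≡1)

map-erase-away : ∀ {k m} (h : Fin k → ℕ) {w} (vs : Vec (Fin k) m) → All (w ≢_) vs →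
  Vec.map (erase w h) vs ≡ Vec.map h vs
map-erase-away h []       []           = refl
map-erase-away h (v ∷ vs) (w≢v ∷ w∉vs) =
  cong₂ _∷_ (erase-other h (λ v≡w → w≢v (sym v≡w))) (map-erase-away h vs w∉vs)

sum-distinct : ∀ {k m} (h : Fin k → ℕ) (ws : Vec (Fin k) m) → Distinct ws →
  Vec.sum (Vec.map h ws) ≤ sum h
sum-distinct h []       []            = z≤n
sum-distinct h (w ∷ ws) (w∉ws ∷ ws!) = begin
  h w + Vec.sum (Vec.map h ws)           ≡⟨ cong (λ xs → h w + Vec.sum xs) (map-erase-away h ws w∉ws) ⟨
  h w + Vec.sum (Vec.map (erase w h) ws) ≤⟨ +-monoʳ-≤ (h w) (sum-distinct (erase w h) ws ws!) ⟩
  h w + sum (erase w h)                  ≡⟨ sum-erase h w ⟨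
  sum h                                  ∎
  where open ≤-Reasoning

distinct-support : ∀ {k m} (h : Fin k → ℕ) (ws : Vec (Fin k) m) → Distinct ws →
  All (λ i → 1 ≤ h i) ws → m ≤ sum h
distinct-support h ws ws! pos = ≤-trans (count ws pos) (sum-distinct h ws ws!)
  where
  count : ∀ {m} (vs : Vec _ m) → All (λ i → 1 ≤ h i) vs → m ≤ Vec.sum (Vec.map h vs)
  count []       []         = z≤n
  count (v ∷ vs) (p ∷ ps) = +-mono-≤ p (count vs ps)

suc-≢ : ∀ {k} {i j : Fin k} → i ≢ j → Fin.suc i ≢ suc j
suc-≢ i≢j si≡sj = i≢j (suc-injective si≡sj)

support : ∀ {k} (h : Fin k → ℕ) → (∀ i → h i ≤ 1) → ∀ m → m ≤ sum h →
  ∃[ ws ] (Distinct {k} {m} ws × All (λ i → 1 ≤ h i) ws)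
support {zero}  h h≤1 zero    _  = [] , [] , []
support {suc k} h h≤1 m       m≤ with h zero in eq
... | zero with support (h ∘ suc) (h≤1 ∘ suc) m m≤
...   | ws , ws! , pos = Vec.map suc ws , AllPairsₚ.map⁺ (AllPairs.map suc-≢ ws!) , Allₚ.map⁺ pos
support {suc k} h h≤1 zero    m≤ | suc zero = [] , [] , []
support {suc k} h h≤1 (suc m) m≤ | suc zero with support (h ∘ suc) (h≤1 ∘ suc) m (≤-pred m≤)
...   | ws , ws! , pos =
  zero ∷ Vec.map suc ws , Allₚ.map⁺ (All.universal (λ _ ()) ws) ∷ AllPairsₚ.map⁺ (AllPairs.map suc-≢ ws!) ,
  subst (1 ≤_) (sym eq) ≤-refl ∷ Allₚ.map⁺ pos
support {suc k} h h≤1 m       m≤ | suc (suc _) with s≤s () ← subst (_≤ 1) eq (h≤1 zero)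

large-or-two : ∀ {k} (h : Fin k → ℕ) → 2 ≤ sum h →
  (∃[ i ] 2 ≤ h i) ⊎ (∃[ i ] ∃[ j ] (i ≢ j × 1 ≤ h i × 1 ≤ h j))
large-or-two h 2≤ with any? (λ i → 2 ≤? h i)
... | yes large = inj₁ large
... | no ¬large with support h (λ i → ≤-pred (≰⇒> (λ 2≤hi → ¬large (i , 2≤hi)))) 2 2≤
...   | i ∷ j ∷ [] , (i≢j ∷ []) ∷ [] ∷ [] , pi ∷ pj ∷ [] = inj₂ (i , j , i≢j , pi , pj)

count-filter : ∀ {k} {A : Set} (f : Fin k → A) (p : A → Bool) →
  length (filterᵇ p (tabulate f)) ≡ sum (λ i → bit (p (f i)))
count-filter {zero}  f p = refl
count-filter {suc k} f p with p (f zero)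
... | true  = cong suc (count-filter (f ∘ suc) p)
... | false = count-filter (f ∘ suc) p

<∸1 : ∀ {k} m → suc k ≤ m ∸ 1 → suc (suc k) ≤ m
<∸1 zero    ()
<∸1 (suc m) k<m∸1 = s≤s k<m∸1

pair-pigeonhole : ∀ {A : Set} {x z u₁ u₂ u₃ : A} → u₁ ≢ u₂ → u₁ ≢ u₃ → u₂ ≢ u₃ →
  (u₁ ≡ x ⊎ u₁ ≡ z) → (u₂ ≡ x ⊎ u₂ ≡ z) → (u₃ ≡ x ⊎ u₃ ≡ z) → ⊥
pair-pigeonhole u₁≢u₂ _     _     (inj₁ p) (inj₁ q) _        = u₁≢u₂ (trans p (sym q))
pair-pigeonhole u₁≢u₂ _     _     (inj₂ p) (inj₂ q) _        = u₁≢u₂ (trans p (sym q))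
pair-pigeonhole _     u₁≢u₃ _     (inj₁ p) (inj₂ _) (inj₁ r) = u₁≢u₃ (trans p (sym r))
pair-pigeonhole _     _     u₂≢u₃ (inj₁ _) (inj₂ q) (inj₂ r) = u₂≢u₃ (trans q (sym r))
pair-pigeonhole _     _     u₂≢u₃ (inj₂ _) (inj₁ q) (inj₁ r) = u₂≢u₃ (trans q (sym r))
pair-pigeonhole _     u₁≢u₃ _     (inj₂ p) (inj₁ _) (inj₂ r) = u₁≢u₃ (trans p (sym r))

avoid-two : ∀ {k} {P : Fin k → Set} {w₁ w₂ w₃} → w₁ ≢ w₂ → w₁ ≢ w₃ → w₂ ≢ w₃ →
  P w₁ → P w₂ → P w₃ → ∀ s s' → ∃[ w ] (P w × w ≢ s × w ≢ s')
avoid-two {w₁ = w₁} {w₂} {w₃} w₁≢w₂ w₁≢w₃ w₂≢w₃ p₁ p₂ p₃ s s'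
  with in-pair w₁ | in-pair w₂ | in-pair w₃
  where
  in-pair : ∀ w → (w ≡ s ⊎ w ≡ s') ⊎ (w ≢ s × w ≢ s')
  in-pair w with w ≟ s | w ≟ s'
  ... | yes w≡s | _        = inj₁ (inj₁ w≡s)
  ... | no  _   | yes w≡s' = inj₁ (inj₂ w≡s')
  ... | no  w≢s | no w≢s'  = inj₂ (w≢s , w≢s')
... | inj₂ avoid₁ | _           | _           = w₁ , p₁ , avoid₁
... | inj₁ _      | inj₂ avoid₂ | _           = w₂ , p₂ , avoid₂
... | inj₁ _      | inj₁ _      | inj₂ avoid₃ = w₃ , p₃ , avoid₃
... | inj₁ hit₁   | inj₁ hit₂   | inj₁ hit₃   = ⊥-elim (pair-pigeonhole w₁≢w₂ w₁≢w₃ w₂≢w₃ hit₁ hit₂ hit₃)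

OneOf4 : ∀ {A : Set} → A → A → A → A → A → Set
OneOf4 t a b c e = t ≡ a ⊎ t ≡ b ⊎ t ≡ c ⊎ t ≡ e

module _ {A : Set} {t a b c e : A} where

  at₁ : t ≡ a → OneOf4 t a b c e
  at₁ = inj₁
  at₂ : t ≡ b → OneOf4 t a b c e
  at₂ = inj₂ ∘ inj₁
  at₃ : t ≡ c → OneOf4 t a b c e
  at₃ = inj₂ ∘ inj₂ ∘ inj₁
  at₄ : t ≡ e → OneOf4 t a b c e
  at₄ = inj₂ ∘ inj₂ ∘ inj₂

  oneOf4-elim : ∀ {R : Set} → (t ≡ a → R) → (t ≡ b → R) → (t ≡ c → R) → (t ≡ e → R) →
    OneOf4 t a b c e → R
  oneOf4-elim f g h k (inj₁ p)                 = f p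
  oneOf4-elim f g h k (inj₂ (inj₁ p))          = g p
  oneOf4-elim f g h k (inj₂ (inj₂ (inj₁ p)))   = h p
  oneOf4-elim f g h k (inj₂ (inj₂ (inj₂ p)))   = k p

record Theta (G : Graph) : Set where
  field
    x z m₁ m₂ m₃ : Fin (Graph.n G)
    x≢z : x ≢ z
    m₁≢m₂ : m₁ ≢ m₂
    m₁≢m₃ : m₁ ≢ m₃
    m₂≢m₃ : m₂ ≢ m₃
    xm₁ : Edge G x m₁
    xm₂ : Edge G x m₂
    xm₃ : Edge G x m₃
    m₁z : Edge G m₁ z
    m₂z : Edge G m₂ z
    m₃z : Edge G m₃ z

module BipartiteGraph (G : Graph) (col : Fin (Graph.n G) → Bool)
                      (proper : ∀ u v → Edge G u v → col u ≢ col v) where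
  open Graph G renaming (sym to adj-sym)

  esym : ∀ {u v} → Edge G u v → Edge G v u
  esym {u} {v} = adj-sym u v

  eneq : ∀ {u v} → Edge G u v → u ≢ v
  eneq {u} uv refl = irrefl u uv

  col2 : ∀ {a b c} → Edge G a b → Edge G b c → col a ≡ col c
  col2 ab bc = trans (¬-not (proper _ _ ab)) (sym (¬-not (≢-sym (proper _ _ bc))))

  noTriangle : ∀ {a b c} → Edge G a b → Edge G b c → Edge G c a → ⊥
  noTriangle ab bc ca = proper _ _ ca (sym (col2 ab bc))

  deg : Fin n → ℕ
  deg x = sum (λ w → bit (adj x w))

  degree≡deg : ∀ x → degree G x ≡ deg x
  degree≡deg x = count-filter (λ i → i) (adj x)

  bit-edge : ∀ {u v} → Edge G u v → bit (adj u v) ≡ 1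
  bit-edge uv rewrite Equivalence.to T-≡ uv = refl

  CommonNbr : Fin n → Fin n → Fin n → Set
  CommonNbr x z w = Edge G x w × Edge G w z

  path2 : Fin n → Fin n → Fin n → ℕ
  path2 x z w = bit (adj x w) * bit (adj w z)

  cm : Fin n → Fin n → ℕ
  cm x z = sum (path2 x z)

  path2≤1 : ∀ x z w → path2 x z w ≤ 1
  path2≤1 x z w with adj x w | adj w z
  ... | true  | true  = ≤-refl
  ... | true  | false = z≤n
  ... | false | _     = z≤n

  path2-witness : ∀ x z w → 1 ≤ path2 x z w → CommonNbr x z w
  path2-witness x z w p with adj x w | adj w z
  ... | true  | true  = tt , tt
  ... | true  | false = ⊥-elim (1+n≰n p)
  ... | false | _     = ⊥-elim (1+n≰n p)

  cm-lower : ∀ {x z m} (ws : Vec (Fin n) m) → Distinct ws → All (CommonNbr x z) ws → m ≤ cm x z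
  cm-lower {x} {z} ws ws! common =
    distinct-support (path2 x z) ws ws! (All.map (λ (xw , wz) → ≤-reflexive (sym (path2≡1 xw wz))) common)
    where
    path2≡1 : ∀ {w} → Edge G x w → Edge G w z → path2 x z w ≡ 1
    path2≡1 xw wz rewrite bit-edge xw | bit-edge wz = refl

  cm≥2 : ∀ {x z w₁ w₂} → w₁ ≢ w₂ → CommonNbr x z w₁ → CommonNbr x z w₂ → 2 ≤ cm x z
  cm≥2 w₁≢w₂ c₁ c₂ = cm-lower (_ ∷ _ ∷ []) ((w₁≢w₂ ∷ []) ∷ [] ∷ []) (c₁ ∷ c₂ ∷ [])

  cm≥3 : ∀ {x z w₁ w₂ w₃} → w₁ ≢ w₂ → w₁ ≢ w₃ → w₂ ≢ w₃ →
    CommonNbr x z w₁ → CommonNbr x z w₂ → CommonNbr x z w₃ → 3 ≤ cm x z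
  cm≥3 w₁≢w₂ w₁≢w₃ w₂≢w₃ c₁ c₂ c₃ =
    cm-lower (_ ∷ _ ∷ _ ∷ []) ((w₁≢w₂ ∷ w₁≢w₃ ∷ []) ∷ (w₂≢w₃ ∷ []) ∷ [] ∷ []) (c₁ ∷ c₂ ∷ c₃ ∷ [])

  cm≥4 : ∀ {x z w₁ w₂ w₃ w₄} → w₁ ≢ w₂ → w₁ ≢ w₃ → w₁ ≢ w₄ → w₂ ≢ w₃ → w₂ ≢ w₄ → w₃ ≢ w₄ →
    CommonNbr x z w₁ → CommonNbr x z w₂ → CommonNbr x z w₃ → CommonNbr x z w₄ → 4 ≤ cm x z
  cm≥4 w₁≢w₂ w₁≢w₃ w₁≢w₄ w₂≢w₃ w₂≢w₄ w₃≢w₄ c₁ c₂ c₃ c₄ =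
    cm-lower (_ ∷ _ ∷ _ ∷ _ ∷ [])
      ((w₁≢w₂ ∷ w₁≢w₃ ∷ w₁≢w₄ ∷ []) ∷ (w₂≢w₃ ∷ w₂≢w₄ ∷ []) ∷ (w₃≢w₄ ∷ []) ∷ [] ∷ [])
      (c₁ ∷ c₂ ∷ c₃ ∷ c₄ ∷ [])

  cm-witnesses : ∀ {x z} m → m ≤ cm x z → ∃[ ws ] (Distinct {n} {m} ws × All (CommonNbr x z) ws)
  cm-witnesses {x} {z} m m≤ with support (path2 x z) (path2≤1 x z) m m≤
  ... | ws , ws! , pos = ws , ws! , All.map (path2-witness x z _) pos

  Ex : Fin n → ℕ
  Ex x = sum (erase x (λ z → cm x z ∸ 1))

  excess-lower : ∀ {x m} (zs : Vec (Fin n) m) → Distinct zs → All (x ≢_) zs →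
    Vec.sum (Vec.map (λ z → cm x z ∸ 1) zs) ≤ Ex x
  excess-lower {x} zs zs! x∉zs =
    subst (_≤ Ex x) (cong Vec.sum (map-erase-away _ zs x∉zs)) (sum-distinct _ zs zs!)

  surplus-lower : ∀ {x z k} → suc k ≤ cm x z → k ≤ cm x z ∸ 1
  surplus-lower = ∸-monoˡ-≤ 1

  -- (the last summand of a vector sum is followed by + 0)
  last-surplus : ∀ {x z k} → suc k ≤ cm x z → k ≤ cm x z ∸ 1 + 0
  last-surplus p = m≤n⇒m≤n+o 0 (surplus-lower p)

  excess≥₁ : ∀ {x z k} → x ≢ z → suc k ≤ cm x z → k ≤ Ex x
  excess≥₁ x≢z p = ≤-trans (last-surplus p) (excess-lower (_ ∷ []) ([] ∷ []) (x≢z ∷ []))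

  excess≥₂ : ∀ {x z₁ z₂ k₁ k₂} → x ≢ z₁ → x ≢ z₂ → z₁ ≢ z₂ →
    suc k₁ ≤ cm x z₁ → suc k₂ ≤ cm x z₂ → k₁ + k₂ ≤ Ex x
  excess≥₂ x≢z₁ x≢z₂ z₁≢z₂ p₁ p₂ =
    ≤-trans (+-mono-≤ (surplus-lower p₁) (last-surplus p₂))
      (excess-lower (_ ∷ _ ∷ []) ((z₁≢z₂ ∷ []) ∷ [] ∷ []) (x≢z₁ ∷ x≢z₂ ∷ []))

  excess≥₃ : ∀ {x z₁ z₂ z₃ k₁ k₂ k₃} → x ≢ z₁ → x ≢ z₂ → x ≢ z₃ → z₁ ≢ z₂ → z₁ ≢ z₃ → z₂ ≢ z₃ →
    suc k₁ ≤ cm x z₁ → suc k₂ ≤ cm x z₂ → suc k₃ ≤ cm x z₃ → k₁ + (k₂ + k₃) ≤ Ex x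
  excess≥₃ x≢z₁ x≢z₂ x≢z₃ z₁≢z₂ z₁≢z₃ z₂≢z₃ p₁ p₂ p₃ =
    ≤-trans (+-mono-≤ (surplus-lower p₁) (+-mono-≤ (surplus-lower p₂) (last-surplus p₃)))
      (excess-lower (_ ∷ _ ∷ _ ∷ []) ((z₁≢z₂ ∷ z₁≢z₃ ∷ []) ∷ (z₂≢z₃ ∷ []) ∷ [] ∷ [])
                    (x≢z₁ ∷ x≢z₂ ∷ x≢z₃ ∷ []))

  -- A bipartite graph has no triangles, so every short cycle is a 4-cycle;
  -- Square C p q reads C as p - q - r - s - p, starting along its edge pq.
  record Square (C : ShortCycle G) (p q : Fin n) : Set where
    field
      r s : Fin n
      pq : p ≢ q
      pr : p ≢ r
      ps : p ≢ s
      qr : q ≢ r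
      qs : q ≢ s
      rs : r ≢ s
      epq : Edge G p q
      eqr : Edge G q r
      ers : Edge G r s
      esp : Edge G s p
      onC : ∀ t → OnCycle G C t → OneOf4 t p q r s
      onp : OnCycle G C p
      onq : OnCycle G C q
      onr : OnCycle G C r
      ons : OnCycle G C s

  rotate : ∀ {C p q} (V : Square C p q) → Square C q (Square.r V)
  rotate {p = p} V = record
    { r = s ; s = p ; pq = qr ; pr = qs ; ps = ≢-sym pq ; qr = rs ; qs = ≢-sym pr ; rs = ≢-sym ps
    ; epq = eqr ; eqr = ers ; ers = esp ; esp = epq
    ; onC = λ t → oneOf4-elim at₄ at₁ at₂ at₃ ∘ onC t
    ; onp = onq ; onq = onr ; onr = ons ; ons = onp }
    where open Square V

  reflect : ∀ {C p q} → Square C p q → Square C q p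
  reflect V = record
    { r = s ; s = r ; pq = ≢-sym pq ; pr = qs ; ps = qr ; qr = ps ; qs = pr ; rs = ≢-sym rs
    ; epq = esym epq ; eqr = esym esp ; ers = esym ers ; esp = esym eqr
    ; onC = λ t → oneOf4-elim at₂ at₁ at₄ at₃ ∘ onC t
    ; onp = onq ; onq = onp ; onr = ons ; ons = onr }
    where open Square V

  squareAt : ∀ C {p q} → EdgeOfCycle G C p q → Square C p q
  squareAt (tri a b c _ _ _ ab bc ca) _ = ⊥-elim (noTriangle ab bc ca)
  squareAt C@(sq a b c e a≢b a≢c a≢e b≢c b≢e c≢e ab bc ce ea) = orient
    where
    base : Square C a b
    base = record
      { r = c ; s = e ; pq = a≢b ; pr = a≢c ; ps = a≢e ; qr = b≢c ; qs = b≢e ; rs = c≢e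
      ; epq = ab ; eqr = bc ; ers = ce ; esp = ea
      ; onC = λ t → id ; onp = at₁ refl ; onq = at₂ refl ; onr = at₃ refl ; ons = at₄ refl }
    orient : ∀ {p q} → EdgeOfCycle G C p q → Square C p q
    orient (inj₁ (inj₁ (refl , refl)))                = base
    orient (inj₁ (inj₂ (refl , refl)))                = reflect base
    orient (inj₂ (inj₁ (inj₁ (refl , refl))))         = rotate base
    orient (inj₂ (inj₁ (inj₂ (refl , refl))))         = reflect (rotate base)
    orient (inj₂ (inj₂ (inj₁ (inj₁ (refl , refl)))))  = rotate (rotate base)
    orient (inj₂ (inj₂ (inj₁ (inj₂ (refl , refl)))))  = reflect (rotate (rotate base))
    orient (inj₂ (inj₂ (inj₂ (inj₁ (refl , refl)))))  = rotate (rotate (rotate base))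
    orient (inj₂ (inj₂ (inj₂ (inj₂ (refl , refl)))))  = reflect (rotate (rotate (rotate base)))

  squareThrough : ∀ C {t} → OnCycle G C t → ∃[ q ] Square C t q
  squareThrough (tri a b c _ _ _ ab bc ca) _ = ⊥-elim (noTriangle ab bc ca)
  squareThrough C@(sq a b c e _ _ _ _ _ _ _ _ _ _) (inj₁ refl) =
    b , squareAt C (inj₁ (inj₁ (refl , refl)))
  squareThrough C@(sq a b c e _ _ _ _ _ _ _ _ _ _) (inj₂ (inj₁ refl)) =
    c , squareAt C (inj₂ (inj₁ (inj₁ (refl , refl))))
  squareThrough C@(sq a b c e _ _ _ _ _ _ _ _ _ _) (inj₂ (inj₂ (inj₁ refl))) =
    e , squareAt C (inj₂ (inj₂ (inj₁ (inj₁ (refl , refl)))))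
  squareThrough C@(sq a b c e _ _ _ _ _ _ _ _ _ _) (inj₂ (inj₂ (inj₂ refl))) =
    a , squareAt C (inj₂ (inj₂ (inj₂ (inj₁ (refl , refl)))))

  different : ∀ C C' {p q} → EdgeOfCycle G C' p q → ¬ OnCycle G C q → ¬ SameCycle G C C'
  different C C' {p} {q} pq∈C' q∉C same =
    q∉C (Square.onq (squareAt C (Equivalence.from (same p q) pq∈C')))

  path1-no-three : ∀ {C C' t₁ t₂ t₃} → MeetInPath1 G C C' → t₁ ≢ t₂ → t₁ ≢ t₃ → t₂ ≢ t₃ →
    OnCycle G C t₁ → OnCycle G C' t₁ → OnCycle G C t₂ → OnCycle G C' t₂ →
    OnCycle G C t₃ → OnCycle G C' t₃ → ⊥
  path1-no-three (x , y , _ , meet , _) t₁≢t₂ t₁≢t₃ t₂≢t₃ a₁ b₁ a₂ b₂ a₃ b₃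
    with Equivalence.to (meet _) (a₁ , b₁) | Equivalence.to (meet _) (a₂ , b₂)
       | Equivalence.to (meet _) (a₃ , b₃)
  ... | inj₁ p | inj₁ q | _      = t₁≢t₂ (trans p (sym q))
  ... | inj₂ p | inj₂ q | _      = t₁≢t₂ (trans p (sym q))
  ... | inj₁ p | inj₂ q | inj₁ r = t₁≢t₃ (trans p (sym r))
  ... | inj₁ p | inj₂ q | inj₂ r = t₂≢t₃ (trans q (sym r))
  ... | inj₂ p | inj₁ q | inj₁ r = t₂≢t₃ (trans q (sym r))
  ... | inj₂ p | inj₁ q | inj₂ r = t₁≢t₃ (trans p (sym r))

  path1-not-single : ∀ {C C' u} → MeetInPath1 G C C' →
    (∀ t → OnCycle G C t → OnCycle G C' t → t ≡ u) → ⊥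
  path1-not-single (x , y , x≢y , meet , _) only-u
    with Equivalence.from (meet x) (inj₁ refl) | Equivalence.from (meet y) (inj₂ refl)
  ... | x∈C , x∈C' | y∈C , y∈C' = x≢y (trans (only-u x x∈C x∈C') (sym (only-u y y∈C y∈C')))

  -- In a bipartite graph of diameter at most 3, distinct vertices of the
  -- same colour are at distance 2, so they have a common neighbour.
  diameter3-common : (∀ u v → DistLe G u v 3) → ∀ {x z} → col x ≡ col z → x ≢ z → 1 ≤ cm x z
  diameter3-common diam {x} {z} same x≢z with diam x z
  ... | _ , _ , nil = ⊥-elim (x≢z refl)
  ... | _ , _ , cons xa nil = ⊥-elim (proper _ _ xa same)
  ... | _ , _ , cons xa (cons az nil) = cm-lower (_ ∷ []) ([] ∷ []) ((xa , az) ∷ [])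
  ... | _ , _ , cons xa (cons ab (cons bz nil)) =
    ⊥-elim (proper _ _ bz (trans (sym (col2 xa ab)) same))
  ... | _ , s≤s (s≤s (s≤s ())) , cons _ (cons _ (cons _ (cons _ _)))

module ThetaFacts (G : Graph) (col : Fin (Graph.n G) → Bool)
                  (proper : ∀ u v → Edge G u v → col u ≢ col v) where
  open BipartiteGraph G col proper
  open Theta

  swap-tips : Theta G → Theta G
  swap-tips θ = record
    { x = z θ ; z = x θ ; m₁ = m₁ θ ; m₂ = m₂ θ ; m₃ = m₃ θ
    ; x≢z = ≢-sym (x≢z θ) ; m₁≢m₂ = m₁≢m₂ θ ; m₁≢m₃ = m₁≢m₃ θ ; m₂≢m₃ = m₂≢m₃ θ
    ; xm₁ = esym (m₁z θ) ; xm₂ = esym (m₂z θ) ; xm₃ = esym (m₃z θ)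
    ; m₁z = esym (xm₁ θ) ; m₂z = esym (xm₂ θ) ; m₃z = esym (xm₃ θ) }

  swap₁₂ : Theta G → Theta G
  swap₁₂ θ = record
    { x = x θ ; z = z θ ; m₁ = m₂ θ ; m₂ = m₁ θ ; m₃ = m₃ θ
    ; x≢z = x≢z θ ; m₁≢m₂ = ≢-sym (m₁≢m₂ θ) ; m₁≢m₃ = m₂≢m₃ θ ; m₂≢m₃ = m₁≢m₃ θ
    ; xm₁ = xm₂ θ ; xm₂ = xm₁ θ ; xm₃ = xm₃ θ ; m₁z = m₂z θ ; m₂z = m₁z θ ; m₃z = m₃z θ }

  swap₁₃ : Theta G → Theta G
  swap₁₃ θ = record
    { x = x θ ; z = z θ ; m₁ = m₃ θ ; m₂ = m₂ θ ; m₃ = m₁ θ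
    ; x≢z = x≢z θ ; m₁≢m₂ = ≢-sym (m₂≢m₃ θ) ; m₁≢m₃ = ≢-sym (m₁≢m₃ θ) ; m₂≢m₃ = ≢-sym (m₁≢m₂ θ)
    ; xm₁ = xm₃ θ ; xm₂ = xm₂ θ ; xm₃ = xm₁ θ ; m₁z = m₃z θ ; m₂z = m₂z θ ; m₃z = m₁z θ }

  tips-cm : (θ : Theta G) → 3 ≤ cm (x θ) (z θ)
  tips-cm θ = cm≥3 (m₁≢m₂ θ) (m₁≢m₃ θ) (m₂≢m₃ θ) (xm₁ θ , m₁z θ) (xm₂ θ , m₂z θ) (xm₃ θ , m₃z θ)

  tip-excess : (θ : Theta G) → 2 ≤ Ex (x θ)
  tip-excess θ = excess≥₁ (x≢z θ) (tips-cm θ)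

  middle-excess : (θ : Theta G) → 2 ≤ Ex (m₁ θ)
  middle-excess θ = excess≥₂ (m₁≢m₂ θ) (m₁≢m₃ θ) (m₂≢m₃ θ)
    (cm≥2 (x≢z θ) (esym (xm₁ θ) , xm₂ θ) (m₁z θ , esym (m₂z θ)))
    (cm≥2 (x≢z θ) (esym (xm₁ θ) , xm₃ θ) (m₁z θ , esym (m₃z θ)))

  square-through-path : ∀ {C x y z} → EdgeOfCycle G C y x → EdgeOfCycle G C y z →
    x ≢ z → y ≢ z → Σ (Square C y x) (λ V → Square.s V ≡ z)
  square-through-path {C} {x} {y} {z} yx∈C yz∈C x≢z y≢z = V , sym (oneOf4-elim
    (λ z≡y → ⊥-elim (y≢z (sym z≡y))) (λ z≡x → ⊥-elim (x≢z (sym z≡x))) z≢r id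
    (Square.onC V z (Square.onq (squareAt C yz∈C))))
    where
    V = squareAt C yx∈C
    z≢r : z ≡ Square.r V → z ≡ Square.s V
    z≢r z≡r = ⊥-elim (proper _ _ (Square.epq (squareAt C yz∈C))
      (trans (col2 (Square.epq V) (Square.eqr V)) (sym (cong col z≡r))))

  -- A branch vertex v of Γ₂ lies on a theta graph: a Γ₂-edge at v lies on a
  -- cycle C ∈ S₂, which meets a neighbour cycle C' in a path x - y - z; the
  -- two 4-cycles through this path form a theta graph with tips x and z,
  -- and v lies on C.
  theta-at-branch : ∀ {v} → BranchVertexΓ2 G v →
    Σ (Theta G) λ θ → OneOf4 v (x θ) (z θ) (m₁ θ) (m₂ θ)
  theta-at-branch {v} (_ , _ , _ , _ , _ , _ , (C , ((C' , nbr) , meets) , v∈C) , _)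
    with meets C' nbr
  ... | x , y , z , _ , y≢z , x≢z , common , shared
    with edges-of y x (inj₁ (inj₂ (refl , refl))) | edges-of y z (inj₂ (inj₁ (refl , refl)))
    where
    edges-of : ∀ p q → UPair G p q x y ⊎ UPair G p q y z → EdgeOfCycle G C p q × EdgeOfCycle G C' p q
    edges-of p q = Equivalence.from (shared p q)
  ... | yx∈C , yx∈C' | yz∈C , yz∈C'
    with square-through-path yx∈C yz∈C x≢z y≢z | square-through-path yx∈C' yz∈C' x≢z y≢z
  ... | V , refl | V' , s'≡z = θ , v-on-θ
    where
    r≢r' : Square.r V ≢ Square.r V'
    r≢r' r≡r' with Equivalence.to (common (Square.r V))
                     (Square.onr V , subst (OnCycle G C') (sym r≡r') (Square.onr V'))
    ... | inj₁ r≡x        = Square.qr V (sym r≡x)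
    ... | inj₂ (inj₁ r≡y) = Square.pr V (sym r≡y)
    ... | inj₂ (inj₂ r≡z) = Square.rs V r≡z
    θ : Theta G
    θ = record
      { x = x ; z = z ; m₁ = y ; m₂ = Square.r V ; m₃ = Square.r V'
      ; x≢z = x≢z ; m₁≢m₂ = Square.pr V ; m₁≢m₃ = Square.pr V' ; m₂≢m₃ = r≢r'
      ; xm₁ = esym (Square.epq V) ; xm₂ = Square.eqr V ; xm₃ = Square.eqr V'
      ; m₁z = Square.epq (squareAt C yz∈C) ; m₂z = Square.ers V
      ; m₃z = subst (Edge G (Square.r V')) s'≡z (Square.ers V') }
    v-on-θ : OneOf4 v x z y (Square.r V)
    v-on-θ = oneOf4-elim at₃ at₁ at₄ at₂ (Square.onC V v (Square.onp (squareAt C v∈C)))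

-- Half of the bipartite Moore bound for degree e + 1 and diameter 3.
halfMoore : ℕ → ℕ
halfMoore e = suc (e + e * e)

-- The arithmetic behind the regularity argument: a colour class of size S
-- whose complement O is at most halfMoore e − 2, inside a graph of order
-- 2 halfMoore e − 4, forces degree e + 1 and excess ≤ 2 (when e ≥ 3).
regularity-arith : ∀ {e S O X d} → 3 ≤ e → S + O + 4 ≡ halfMoore e + halfMoore e →
  O + 2 ≤ halfMoore e → S + X ≤ 1 + d * e → d ≤ suc e → X ≤ 2 × d ≡ suc e
regularity-arith {e} {S} {O} {X} {d} 3≤e order O-small SX≤ d≤ = X≤2 , d≡
  where
  open ≤-Reasoning
  Q = halfMoore e
  Q≤S+2 : Q ≤ S + 2
  Q≤S+2 = +-cancelʳ-≤ Q Q (S + 2) (begin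
    Q + Q             ≡⟨ order ⟨
    S + O + 4         ≡⟨ solve 2 (λ s o → s :+ o :+ con 4 := (s :+ con 2) :+ (o :+ con 2)) refl S O ⟩
    (S + 2) + (O + 2) ≤⟨ +-monoʳ-≤ (S + 2) O-small ⟩
    (S + 2) + Q       ∎)
    where open +-*-Solver
  d≰e : ¬ d ≤ e
  d≰e d≤e = 1+n≰n (≤-trans 3≤e (+-cancelʳ-≤ (e * e) e 2 (+-cancelˡ-≤ 2 _ _ (begin
    1 + Q                ≤⟨ +-monoʳ-≤ 1 Q≤S+2 ⟩
    1 + (S + 2)          ≡⟨ cong suc (+-comm S 2) ⟩
    3 + S                ≤⟨ +-monoʳ-≤ 3 (m≤m+n S X) ⟩
    3 + (S + X)          ≤⟨ +-monoʳ-≤ 3 SX≤ ⟩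
    3 + (1 + d * e)      ≤⟨ +-monoʳ-≤ 4 (*-monoˡ-≤ e d≤e) ⟩
    2 + (2 + e * e)      ∎))))
  d≡ : d ≡ suc e
  d≡ = ≤-antisym d≤ (≰⇒> d≰e)
  X≤2 : X ≤ 2
  X≤2 = +-cancelˡ-≤ S X 2 (≤-trans (subst (λ d → S + X ≤ 1 + d * e) d≡ SX≤) Q≤S+2)

module PathCounting (G : Graph) (col : Fin (Graph.n G) → Bool)
                    (proper : ∀ u v → Edge G u v → col u ≢ col v) (e : ℕ)
                    (max-deg : ∀ v → degree G v ≤ suc e)
                    (diam : ∀ u v → DistLe G u v 3) where
  open Graph G renaming (sym to adj-sym)
  open BipartiteGraph G col proper

  deg≤ : ∀ v → deg v ≤ suc e
  deg≤ v = subst (_≤ suc e) (degree≡deg v) (max-deg v)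

  -- the closed walks x - w - x are the edges at x
  cm-self : ∀ x → cm x x ≡ deg x
  cm-self x = sum-cong-≗ back-and-forth
    where
    back-and-forth : ∀ w → path2 x x w ≡ bit (adj x w)
    back-and-forth w with adj x w in xw
    ... | false = refl
    ... | true  rewrite Equivalence.to T-≡ (adj-sym x w (Equivalence.from T-≡ xw)) = refl

  -- counting the paths x - w - z by their middle vertex w
  paths2-bound : ∀ x → sum (cm x) ≤ deg x * suc e
  paths2-bound x = begin
    sum (λ z → sum (λ w → bit (adj x w) * bit (adj w z)))
      ≡⟨ ∑-comm (λ w z → bit (adj x w) * bit (adj w z)) ⟨
    sum (λ w → sum (λ z → bit (adj x w) * bit (adj w z)))
      ≡⟨ sum-cong-≗ (λ w → *-distribˡ-sum (bit (adj x w)) (λ z → bit (adj w z))) ⟨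
    sum (λ w → bit (adj x w) * deg w)
      ≤⟨ sum-mono (λ w → *-monoʳ-≤ (bit (adj x w)) (deg≤ w)) ⟩
    sum (λ w → bit (adj x w) * suc e)
      ≡⟨ *-distribʳ-sum (suc e) (λ w → bit (adj x w)) ⟨
    deg x * suc e ∎
    where open ≤-Reasoning

  inClass : Fin n → Fin n → ℕ
  inClass x z = bit (does (col x Bool.≟ col z))

  inClass-self : ∀ x → inClass x x ≡ 1
  inClass-self x rewrite dec-true (col x Bool.≟ col x) refl = refl

  class : Fin n → ℕ
  class x = sum (inClass x)

  -- Each z ≠ x in the colour class of x is the end of at least one path
  -- x - w - z, and of Ex x surplus ones in total; x itself ends deg x paths.
  class-excess-deg : ∀ x → class x + Ex x + deg x ≤ 1 + deg x * suc e
  class-excess-deg x = begin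
    class x + Ex x + deg x
      ≡⟨ cong (class x + Ex x +_) (sum-point x (deg x)) ⟨
    class x + Ex x + sum (point x (deg x))
      ≡⟨ cong (_+ sum (point x (deg x))) (∑-distrib-+ (inClass x) excess) ⟨
    sum (λ z → inClass x z + excess z) + sum (point x (deg x))
      ≡⟨ ∑-distrib-+ (λ z → inClass x z + excess z) (point x (deg x)) ⟨
    sum (λ z → inClass x z + excess z + point x (deg x) z)
      ≤⟨ sum-mono per-vertex ⟩
    sum (λ z → point x 1 z + cm x z)
      ≡⟨ ∑-distrib-+ (point x 1) (cm x) ⟩
    sum (point x 1) + sum (cm x)
      ≡⟨ cong (_+ sum (cm x)) (sum-point x 1) ⟩
    1 + sum (cm x)
      ≤⟨ +-monoʳ-≤ 1 (paths2-bound x) ⟩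
    1 + deg x * suc e ∎
    where
    open ≤-Reasoning
    excess : Fin n → ℕ
    excess = erase x (λ z → cm x z ∸ 1)
    per-vertex : ∀ z → inClass x z + excess z + point x (deg x) z
                         ≤ point x 1 z + cm x z
    per-vertex z with z ≟ x
    ... | yes refl rewrite inClass-self z | cm-self z = ≤-refl
    ... | no z≢x with col x Bool.≟ col z
    ...   | yes same = ≤-reflexive (trans (+-identityʳ _)
                         (m+[n∸m]≡n (diameter3-common diam same (≢-sym z≢x))))
    ...   | no _     = subst (_≤ cm x z) (sym (+-identityʳ _)) (m∸n≤m (cm x z) 1)

  class-excess : ∀ x → class x + Ex x ≤ 1 + deg x * e
  class-excess x = +-cancelˡ-≤ (deg x) _ _ (subst₂ _≤_
    (+-comm (class x + Ex x) (deg x))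
    (trans (cong (1 +_) (*-suc (deg x) e)) (sym (+-suc (deg x) (deg x * e))))
    (class-excess-deg x))

  class-partition : ∀ {x y} → col x ≢ col y → class x + class y ≡ n
  class-partition {x} {y} x≢y = begin
    class x + class y
      ≡⟨ ∑-distrib-+ (inClass x) _ ⟨
    sum (λ z → inClass x z + inClass y z)
      ≡⟨ sum-cong-≗ (λ z → two-classes (col x) (col y) (col z) x≢y) ⟩
    sum {n} (λ _ → 1)
      ≡⟨ sum-ones ⟩
    n ∎
    where
    open ≡-Reasoning
    two-classes : ∀ a b c → a ≢ b → bit (does (a Bool.≟ c)) + bit (does (b Bool.≟ c)) ≡ 1
    two-classes true  true  _     a≢b = ⊥-elim (a≢b refl)
    two-classes false false _     a≢b = ⊥-elim (a≢b refl)
    two-classes true  false true  _   = refl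
    two-classes true  false false _   = refl
    two-classes false true  true  _   = refl
    two-classes false true  false _   = refl

  class-colour : ∀ {t x} → col t ≡ col x → class t ≡ class x
  class-colour same = sum-cong-≗ (λ z → cong (λ c → bit (does (c Bool.≟ col z))) same)

  small-class : ∀ {z} → 2 ≤ Ex z → class z + 2 ≤ halfMoore e
  small-class {z} 2≤Ez = ≤-trans (+-monoʳ-≤ (class z) 2≤Ez)
                           (≤-trans (class-excess z) (s≤s (*-monoˡ-≤ e (deg≤ z))))

  opposite-small : 3 ≤ e → n + 4 ≡ halfMoore e + halfMoore e →
    ∀ {t a b} → col t ≡ col a → col a ≢ col b → class b + 2 ≤ halfMoore e →
    Ex t ≤ 2 × deg t ≡ suc e
  opposite-small 3≤e order {t} t~a a≢b b-small = regularity-arith 3≤e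
    (trans (cong (_+ 4) (trans (cong (_+ class _) (class-colour t~a)) (class-partition a≢b))) order)
    b-small (class-excess t) (deg≤ t)

  regular : 3 ≤ e → n + 4 ≡ halfMoore e + halfMoore e →
    ∀ {x y} → col x ≢ col y → 2 ≤ Ex x → 2 ≤ Ex y → ∀ t → Ex t ≤ 2 × deg t ≡ suc e
  regular 3≤e order {x} {y} x≢y 2≤Ex 2≤Ey t with col t Bool.≟ col x
  ... | yes t~x = opposite-small 3≤e order t~x x≢y (small-class 2≤Ey)
  ... | no  t≁x = opposite-small 3≤e order (trans (¬-not t≁x) (sym (¬-not (≢-sym x≢y))))
                    (≢-sym x≢y) (small-class 2≤Ex)

module SmallExcess (G : Graph) (col : Fin (Graph.n G) → Bool)
                   (proper : ∀ u v → Edge G u v → col u ≢ col v)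
                   (Ex≤2 : ∀ t → BipartiteGraph.Ex G col proper t ≤ 2) where
  open BipartiteGraph G col proper

  excess≥3 : ∀ {p} → 3 ≤ Ex p → ⊥
  excess≥3 {p} 3≤Ex = 1+n≰n (≤-trans 3≤Ex (Ex≤2 p))

  no-4-common : ∀ {p r} → p ≢ r → 4 ≤ cm p r → ⊥
  no-4-common p≢r 4≤ = excess≥3 (excess≥₁ p≢r 4≤)

  no-3-2-common : ∀ {p r₁ r₂} → p ≢ r₁ → p ≢ r₂ → r₁ ≢ r₂ → 3 ≤ cm p r₁ → 2 ≤ cm p r₂ → ⊥
  no-3-2-common p≢r₁ p≢r₂ r₁≢r₂ 3≤ 2≤ = excess≥3 (excess≥₂ p≢r₁ p≢r₂ r₁≢r₂ 3≤ 2≤)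

  no-2-2-2-common : ∀ {p r₁ r₂ r₃} → p ≢ r₁ → p ≢ r₂ → p ≢ r₃ → r₁ ≢ r₂ → r₁ ≢ r₃ → r₂ ≢ r₃ →
    2 ≤ cm p r₁ → 2 ≤ cm p r₂ → 2 ≤ cm p r₃ → ⊥
  no-2-2-2-common p≢r₁ p≢r₂ p≢r₃ r₁≢r₂ r₁≢r₃ r₂≢r₃ 2≤₁ 2≤₂ 2≤₃ =
    excess≥3 (excess≥₃ p≢r₁ p≢r₂ p≢r₃ r₁≢r₂ r₁≢r₃ r₂≢r₃ 2≤₁ 2≤₂ 2≤₃)

  -- The middle m₁ of a theta graph: its only 4-cycles are those of the theta.
  module Middle (θ : Theta G) where
    open Theta θ

    cm-m₂ : 2 ≤ cm m₁ m₂
    cm-m₂ = cm≥2 x≢z (esym xm₁ , xm₂) (m₁z , esym m₂z)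

    cm-m₃ : 2 ≤ cm m₁ m₃
    cm-m₃ = cm≥2 x≢z (esym xm₁ , xm₃) (m₁z , esym m₃z)

    partner : ∀ {o} → m₁ ≢ o → 2 ≤ cm m₁ o → o ≡ m₂ ⊎ o ≡ m₃
    partner {o} m₁≢o 2≤ with o ≟ m₂ | o ≟ m₃
    ... | yes o≡m₂ | _        = inj₁ o≡m₂
    ... | no  _    | yes o≡m₃ = inj₂ o≡m₃
    ... | no  o≢m₂ | no  o≢m₃ =
      ⊥-elim (no-2-2-2-common m₁≢m₂ m₁≢m₃ m₁≢o m₂≢m₃ (≢-sym o≢m₂) (≢-sym o≢m₃) cm-m₂ cm-m₃ 2≤)

    partner-common : ∀ {o w} → (o ≡ m₂ ⊎ o ≡ m₃) → Edge G m₁ w → Edge G w o → w ≡ x ⊎ w ≡ z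
    partner-common {o} {w} o-partner m₁w wo with w ≟ x | w ≟ z
    ... | yes w≡x | _        = inj₁ w≡x
    ... | no  _   | yes w≡z  = inj₂ w≡z
    ... | no  w≢x | no w≢z with o-partner
    ...   | inj₁ refl = ⊥-elim (no-3-2-common m₁≢m₂ m₁≢m₃ m₂≢m₃
              (cm≥3 x≢z (≢-sym w≢x) (≢-sym w≢z) (esym xm₁ , xm₂) (m₁z , esym m₂z) (m₁w , wo)) cm-m₃)
    ...   | inj₂ refl = ⊥-elim (no-3-2-common m₁≢m₃ m₁≢m₂ (≢-sym m₂≢m₃)
              (cm≥3 x≢z (≢-sym w≢x) (≢-sym w≢z) (esym xm₁ , xm₃) (m₁z , esym m₃z) (m₁w , wo)) cm-m₂)

    square-at-middle : ∀ {C s} (V : Square C m₁ s) →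
      (s ≡ x ⊎ s ≡ z) × (Square.s V ≡ x ⊎ Square.s V ≡ z) × (Square.r V ≡ m₂ ⊎ Square.r V ≡ m₃)
    square-at-middle V =
      partner-common r-partner epq eqr , partner-common r-partner (esym esp) (esym ers) , r-partner
      where
      open Square V
      r-partner = partner pr (cm≥2 qs (epq , eqr) (esym esp , esym ers))

    Γ₂-neighbours : ∀ {t} → EdgeOfΓ2 G m₁ t → t ≡ x ⊎ t ≡ z
    Γ₂-neighbours (C , _ , m₁t∈C) = proj₁ (square-at-middle (squareAt C m₁t∈C))

    not-branch : ¬ BranchVertexΓ2 G m₁
    not-branch (_ , _ , _ , u₁≢u₂ , u₁≢u₃ , u₂≢u₃ , e₁ , e₂ , e₃ , _) =
      pair-pigeonhole u₁≢u₂ u₁≢u₃ u₂≢u₃ (Γ₂-neighbours e₁) (Γ₂-neighbours e₂) (Γ₂-neighbours e₃)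

    tips-on : ∀ {C s s'} → (s ≡ x ⊎ s ≡ z) → (s' ≡ x ⊎ s' ≡ z) → s ≢ s' →
      OnCycle G C s → OnCycle G C s' → OnCycle G C x × OnCycle G C z
    tips-on (inj₁ refl) (inj₁ refl) s≢s' _   _    = ⊥-elim (s≢s' refl)
    tips-on (inj₁ refl) (inj₂ refl) _    s∈C s'∈C = s∈C , s'∈C
    tips-on (inj₂ refl) (inj₁ refl) _    s∈C s'∈C = s'∈C , s∈C
    tips-on (inj₂ refl) (inj₂ refl) s≢s' _   _    = ⊥-elim (s≢s' refl)

    -- A 4-cycle D = m₁ - s - r - s' in S₁ and the square m₁ - x - m - z, for a
    -- partner m ≠ r, would be neighbours sharing the three vertices m₁, x, z.
    three-shared : ∀ {D s m} (V : Square D m₁ s) → InS1 G D →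
      (s ≡ x ⊎ s ≡ z) → (Square.s V ≡ x ⊎ Square.s V ≡ z) →
      m ≢ Square.r V → m₁ ≢ m → Edge G x m → Edge G m z → ⊥
    three-shared {D} {s} {m} V D∈S1 s-tip s'-tip m≢r m₁≢m xm mz =
      path1-no-three {C = D} {C' = D'} meet (≢-sym (eneq xm₁)) (eneq m₁z) x≢z
        onp (at₁ refl) (proj₁ x,z∈D) (at₂ refl) (proj₂ x,z∈D) (at₄ refl)
      where
      open Square V
      D' : ShortCycle G
      D' = sq m₁ x m z (≢-sym (eneq xm₁)) m₁≢m (eneq m₁z) (eneq xm) x≢z (eneq mz)
             (esym xm₁) xm mz (esym m₁z)
      x,z∈D = tips-on s-tip s'-tip qs onq ons
      not-tip : ∀ {t} → (t ≡ x ⊎ t ≡ z) → m ≢ t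
      not-tip (inj₁ refl) m≡x = eneq xm (sym m≡x)
      not-tip (inj₂ refl) m≡z = eneq mz m≡z
      m∉D : ¬ OnCycle G D m
      m∉D m∈D = oneOf4-elim (≢-sym m₁≢m) (not-tip s-tip) m≢r (not-tip s'-tip) (onC m m∈D)
      meet : MeetInPath1 G D D'
      meet = proj₂ D∈S1 D' (different D D' {x} {m} (inj₂ (inj₁ (inj₁ (refl , refl)))) m∉D ,
                            m₁ , onp , at₁ refl)

    -- ... and m₁ lies on no cycle of S₁: the partner not on a 4-cycle through
    -- m₁ gives a square sharing three vertices with it.
    not-on-S1 : ∀ {D} → InS1 G D → ¬ OnCycle G D m₁
    not-on-S1 {D} D∈S1 m₁∈D with squareThrough D m₁∈D
    ... | s , V with square-at-middle V
    ...   | s-tip , s'-tip , inj₁ r≡m₂ = three-shared V D∈S1 s-tip s'-tip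
            (λ m₃≡r → m₂≢m₃ (trans (sym r≡m₂) (sym m₃≡r))) m₁≢m₃ xm₃ m₃z
    ...   | s-tip , s'-tip , inj₂ r≡m₃ = three-shared V D∈S1 s-tip s'-tip
            (λ m₂≡r → m₂≢m₃ (trans m₂≡r r≡m₃)) m₁≢m₂ xm₂ m₂z

module RegularSmallExcess (G : Graph) (col : Fin (Graph.n G) → Bool)
                          (proper : ∀ u v → Edge G u v → col u ≢ col v)
                          (Ex≤2 : ∀ t → BipartiteGraph.Ex G col proper t ≤ 2)
                          (d : ℕ) (regular : ∀ t → BipartiteGraph.deg G col proper t ≡ d)
                          (diam : ∀ u v → DistLe G u v 3) where
  open Graph G using (n; adj)
  open BipartiteGraph G col proper
  open ThetaFacts G col proper
  open SmallExcess G col proper Ex≤2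

  -- Outline: z is not adjacent to u, so every neighbour w ≠ x of u reaches z
  -- through an outer neighbour g of z (one outside the theta graph). As u
  -- and z have the same degree d and z has only d − 3 outer neighbours,
  -- the paths from u to outer vertices have surplus at least 2. Both ways
  -- of realising this surplus produce a 4-cycle through u that meets D in
  -- three vertices or in u alone, contradicting D ∈ S₁.
  module Tip (θ : Theta G) {u D} (xu : Edge G (Theta.x θ) u)
             (D∈S1 : InS1 G D) (u∈D : OnCycle G D u) where
    open Theta θ

    -- u is no middle (middles avoid S₁), and a fourth common neighbour of the
    -- tips is forbidden
    z≁u : ¬ Edge G z u
    z≁u zu with u ≟ m₁ | u ≟ m₂ | u ≟ m₃
    ... | yes refl | _        | _        = Middle.not-on-S1 θ D∈S1 u∈D
    ... | no  _    | yes refl | _        = Middle.not-on-S1 (swap₁₂ θ) D∈S1 u∈D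
    ... | no  _    | no  _    | yes refl = Middle.not-on-S1 (swap₁₃ θ) D∈S1 u∈D
    ... | no u≢m₁  | no u≢m₂  | no u≢m₃  = no-4-common x≢z
      (cm≥4 m₁≢m₂ m₁≢m₃ (≢-sym u≢m₁) m₂≢m₃ (≢-sym u≢m₂) (≢-sym u≢m₃)
        (xm₁ , m₁z) (xm₂ , m₂z) (xm₃ , m₃z) (xu , esym zu))

    u≢nbr-of-z : ∀ {k} → Edge G z k → u ≢ k
    u≢nbr-of-z zk refl = z≁u zk

    avoids-middles : ∀ {w k} → Edge G u w → x ≢ w → z ≢ w → Edge G x k → Edge G k z → ¬ Edge G w k
    avoids-middles uw x≢w z≢w xk kz wk = no-3-2-common x≢z x≢w z≢w (tips-cm θ)
      (cm≥2 (u≢nbr-of-z (esym kz)) (xu , uw) (xk , esym wk))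

    Outer : Fin n → Set
    Outer g = g ≢ m₁ × g ≢ m₂ × g ≢ m₃ × Edge G z g

    nbr-z outer₁ outer₂ outer : Fin n → ℕ
    nbr-z g = bit (adj z g)
    outer₁  = erase m₁ nbr-z
    outer₂  = erase m₂ outer₁
    outer   = erase m₃ outer₂

    outer-one : ∀ {g} → Outer g → outer g ≡ 1
    outer-one (g≢m₁ , g≢m₂ , g≢m₃ , zg) rewrite
      erase-other outer₂ g≢m₃ | erase-other outer₁ g≢m₂ | erase-other nbr-z g≢m₁ = bit-edge zg

    outer-positive : ∀ {g} → 1 ≤ outer g → Outer g
    outer-positive {g} 1≤ with erase-positive {h = outer₂} {g} 1≤
    ... | g≢m₃ , 1≤₂ with erase-positive {h = outer₁} {g} 1≤₂
    ...   | g≢m₂ , 1≤₁ with erase-positive {h = nbr-z} {g} 1≤₁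
    ...     | g≢m₁ , 1≤bit = g≢m₁ , g≢m₂ , g≢m₃ , edge 1≤bit
      where
      edge : 1 ≤ nbr-z g → Edge G z g
      edge p with adj z g
      ... | true = tt

    deg-z : deg z ≡ 3 + sum outer
    deg-z = begin
      sum nbr-z            ≡⟨ sum-erase-one nbr-z (bit-edge (esym m₁z)) ⟩
      suc (sum outer₁)     ≡⟨ cong suc (sum-erase-one outer₁
                                (trans (erase-other nbr-z (≢-sym m₁≢m₂)) (bit-edge (esym m₂z)))) ⟩
      2 + sum outer₂       ≡⟨ cong (2 +_) (sum-erase-one outer₂
                                (trans (erase-other outer₁ (≢-sym m₂≢m₃))
                                  (trans (erase-other nbr-z (≢-sym m₁≢m₃)) (bit-edge (esym m₃z))))) ⟩
      3 + sum outer        ∎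
      where open ≡-Reasoning

    -- every neighbour w ≠ x of u reaches z through an outer vertex:
    -- w has the colour of z, so the diameter bound gives w - g - z
    route : ∀ {w} → Edge G u w → w ≢ x → ∃[ g ] (Edge G w g × Outer g)
    route {w} uw w≢x with cm-witnesses 1 (diameter3-common diam w~z w≢z)
      where
      w~z : col w ≡ col z
      w~z = trans (col2 (esym uw) (esym xu)) (col2 xm₁ m₁z)
      w≢z : w ≢ z
      w≢z refl = z≁u (esym uw)
    ... | g ∷ [] , _ , (wg , gz) ∷ [] =
      g , wg , avoid xm₁ m₁z , avoid xm₂ m₂z , avoid xm₃ m₃z , esym gz
      where
      z≢w : z ≢ w
      z≢w refl = z≁u (esym uw)
      avoid : ∀ {k} → Edge G x k → Edge G k z → g ≢ k
      avoid xk kz refl = avoids-middles uw (≢-sym w≢x) z≢w xk kz wg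

    outer-surplus : Fin n → ℕ
    outer-surplus g = outer g * (cm u g ∸ 1)

    regroup : sum (λ w → bit (adj u w) * sum (λ g → outer g * bit (adj w g)))
              ≡ sum (λ g → outer g * cm u g)
    regroup = begin
      sum (λ w → bit (adj u w) * sum (λ g → outer g * bit (adj w g)))
        ≡⟨ sum-cong-≗ (λ w → *-distribˡ-sum (bit (adj u w)) (λ g → outer g * bit (adj w g))) ⟩
      sum (λ w → sum (λ g → bit (adj u w) * (outer g * bit (adj w g))))
        ≡⟨ ∑-comm (λ w g → bit (adj u w) * (outer g * bit (adj w g))) ⟩
      sum (λ g → sum (λ w → bit (adj u w) * (outer g * bit (adj w g))))
        ≡⟨ sum-cong-≗ (λ g → sum-cong-≗ (λ w → x∙yz≈y∙xz (bit (adj u w)) (outer g) _)) ⟩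
      sum (λ g → sum (λ w → outer g * path2 u g w))
        ≡⟨ sum-cong-≗ (λ g → *-distribˡ-sum (outer g) (path2 u g)) ⟨
      sum (λ g → outer g * cm u g) ∎
      where open ≡-Reasoning

    -- every neighbour w ≠ x of u starts a path u - w - g to an outer vertex,
    -- so counting these paths by their end g bounds the degree of u
    paths-to-outer : deg u ≤ 1 + sum (λ g → outer g * cm u g)
    paths-to-outer = begin
      deg u                                                  ≤⟨ sum-mono per-nbr ⟩
      sum (λ w → point x 1 w + bit (adj u w) * reach w)      ≡⟨ ∑-distrib-+ (point x 1) _ ⟩
      sum (point x 1) + sum (λ w → bit (adj u w) * reach w)  ≡⟨ cong₂ _+_ (sum-point x 1) regroup ⟩
      1 + sum (λ g → outer g * cm u g)                       ∎
      where
      open ≤-Reasoning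
      reach : Fin n → ℕ
      reach w = sum (λ g → outer g * bit (adj w g))
      per-nbr : ∀ w → bit (adj u w) ≤ point x 1 w + bit (adj u w) * reach w
      per-nbr w with w ≟ x
      ... | yes _ = ≤-trans (bit≤1 (adj u w)) (m≤m+n 1 _)
      ... | no w≢x with adj u w in uw
      ...   | false = z≤n
      ...   | true with route (Equivalence.from T-≡ uw) w≢x
      ...     | g , wg , out = ≤-trans
                  (distinct-support _ (g ∷ []) ([] ∷ [])
                    (≤-reflexive (sym (cong₂ _*_ (outer-one out) (bit-edge wg))) ∷ []))
                  (≤-reflexive (sym (+-identityʳ (reach w))))

    split-surplus : sum (λ g → outer g * cm u g) ≤ sum outer + sum outer-surplus
    split-surplus = ≤-trans (sum-mono (λ g → split (outer g) (cm u g)))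
                            (≤-reflexive (∑-distrib-+ outer outer-surplus))
      where
      split : ∀ t m → t * m ≤ t + t * (m ∸ 1)
      split t zero    = ≤-trans (≤-reflexive (*-zeroʳ t)) z≤n
      split t (suc m) = ≤-reflexive (*-suc t m)

    -- u and z have the same degree, but z has only 3 + sum outer neighbours
    two-outer-surplus : 2 ≤ sum outer-surplus
    two-outer-surplus = +-cancelˡ-≤ (suc (sum outer)) 2 (sum outer-surplus) (begin
      suc (sum outer) + 2                ≡⟨ +-comm (suc (sum outer)) 2 ⟩
      3 + sum outer                      ≡⟨ deg-z ⟨
      deg z                              ≡⟨ trans (regular z) (sym (regular u)) ⟩
      deg u                              ≤⟨ paths-to-outer ⟩
      1 + sum (λ g → outer g * cm u g)   ≤⟨ +-monoʳ-≤ 1 split-surplus ⟩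
      suc (sum outer) + sum outer-surplus      ∎)
      where open ≤-Reasoning

    surplus-info : ∀ {k g} → suc k ≤ outer-surplus g → Outer g × suc (suc k) ≤ cm u g
    surplus-info {k} {g} k<surplus = out , <∸1 (cm u g) (≤-trans k<surplus
      (≤-reflexive (trans (cong (_* (cm u g ∸ 1)) (outer-one out)) (+-identityʳ _))))
      where
      positive-factor : ∀ {a b} → suc k ≤ a * b → 1 ≤ a
      positive-factor {suc a} _ = s≤s z≤n
      out : Outer g
      out = outer-positive (positive-factor k<surplus)

    u≢outer : ∀ {g} → Outer g → u ≢ g
    u≢outer (_ , _ , _ , zg) = u≢nbr-of-z zg

    opposite-cm : ∀ {C s₀} (V : Square C u s₀) → 2 ≤ cm u (Square.r V)
    opposite-cm V = cm≥2 qs (epq , eqr) (esym esp , esym ers)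
      where open Square V

    -- Large surplus at one outer vertex g, i.e. cm u g ≥ 3: then g must be
    -- the vertex r opposite to u on D = u - s₀ - r - s, and a third path
    -- u - w - r closes a square u - s₀ - r - w sharing u, s₀, r with D.
    one-large : ∀ {s₀ g} (V : Square D u s₀) → Outer g → 3 ≤ cm u g → ⊥
    one-large {s₀} {g} V out 3≤ with Square.r V ≟ g
    ... | no r≢g = no-3-2-common (u≢outer out) (Square.pr V) (≢-sym r≢g) 3≤ (opposite-cm V)
    ... | yes refl with cm-witnesses 3 3≤
    ...   | w₁ ∷ w₂ ∷ w₃ ∷ [] , (w₁≢w₂ ∷ w₁≢w₃ ∷ []) ∷ (w₂≢w₃ ∷ []) ∷ [] ∷ [] , c₁ ∷ c₂ ∷ c₃ ∷ []
            with avoid-two w₁≢w₂ w₁≢w₃ w₂≢w₃ c₁ c₂ c₃ s₀ (Square.s V)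
    ...     | w , (uw , wr) , w≢s₀ , w≢s =
      path1-no-three {C = D} {C' = D'} meet pq pr qr onp (at₁ refl) onq (at₂ refl) onr (at₃ refl)
      where
      open Square V
      D' : ShortCycle G
      D' = sq u s₀ r w pq pr (eneq uw) qr (≢-sym w≢s₀) (≢-sym (eneq wr)) epq eqr (esym wr) (esym uw)
      w∉D : ¬ OnCycle G D w
      w∉D w∈D = oneOf4-elim (λ w≡u → eneq uw (sym w≡u)) w≢s₀ (eneq wr) w≢s (onC w w∈D)
      meet : MeetInPath1 G D D'
      meet = proj₂ D∈S1 D' (different D D' {r} {w} (inj₂ (inj₂ (inj₁ (inj₁ (refl , refl))))) w∉D ,
                            u , onp , at₁ refl)

    outer-private : ∀ {g₁ g₂ w} → g₁ ≢ g₂ → Outer g₁ → Outer g₂ →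
      Edge G w g₁ → Edge G w g₂ → w ≢ z → ⊥
    outer-private {w = w} g₁≢g₂ (g₁≢m₁ , g₁≢m₂ , g₁≢m₃ , zg₁) (_ , _ , _ , zg₂) wg₁ wg₂ w≢z =
      no-3-2-common (≢-sym x≢z) (≢-sym w≢z) x≢w
        (cm≥3 m₁≢m₂ m₁≢m₃ m₂≢m₃ (esym m₁z , esym xm₁) (esym m₂z , esym xm₂) (esym m₃z , esym xm₃))
        (cm≥2 g₁≢g₂ (zg₁ , esym wg₁) (zg₂ , esym wg₂))
      where
      x≢w : x ≢ w
      x≢w refl = no-4-common x≢z (cm≥4 m₁≢m₂ m₁≢m₃ (≢-sym g₁≢m₁) m₂≢m₃ (≢-sym g₁≢m₂) (≢-sym g₁≢m₃)
                   (xm₁ , m₁z) (xm₂ , m₂z) (xm₃ , m₃z) (wg₁ , esym zg₁))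

    -- Surplus at the outer vertex r opposite to u on D = u - s₀ - r - s and at
    -- another outer vertex g: two paths u - w - g close a square
    -- u - w₁ - g - w₂ which meets D in u alone.
    meets-only-u : ∀ {s₀ g} (V : Square D u s₀) → Square.r V ≢ g → Outer (Square.r V) → Outer g →
      2 ≤ cm u g → ⊥
    meets-only-u {s₀} {g} V r≢g out-r out-g 2≤ with cm-witnesses 2 2≤
    ... | w₁ ∷ w₂ ∷ [] , (w₁≢w₂ ∷ []) ∷ [] ∷ [] , (uw₁ , w₁g) ∷ (uw₂ , w₂g) ∷ [] =
      path1-not-single {C = D} {C' = D'} meet only-u
      where
      open Square V
      g~u : col g ≡ col u
      g~u = col2 (esym w₁g) (esym uw₁)
      path-avoids : ∀ {w} → Edge G u w → Edge G w g → ¬ OnCycle G D w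
      path-avoids {w} uw wg w∈D = oneOf4-elim
        (λ w≡u → eneq uw (sym w≡u))
        (λ w≡s₀ → outer-private r≢g out-r out-g (subst (λ t → Edge G t r) (sym w≡s₀) eqr) wg w≢z)
        (λ w≡r → proper _ _ (subst (λ t → Edge G t g) w≡r wg) (col2 (esym (proj₂ (proj₂ (proj₂ out-r))))
                                                                    (proj₂ (proj₂ (proj₂ out-g)))))
        (λ w≡s → outer-private r≢g out-r out-g (subst (λ t → Edge G t r) (sym w≡s) (esym ers)) wg w≢z)
        (onC w w∈D)
        where
        w≢z : w ≢ z
        w≢z w≡z = z≁u (subst (λ t → Edge G t u) w≡z (esym uw))
      g∉D : ¬ OnCycle G D g
      g∉D g∈D = oneOf4-elim
        (λ g≡u → u≢outer out-g (sym g≡u))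
        (λ g≡s₀ → proper _ _ epq (sym (trans (cong col (sym g≡s₀)) g~u)))
        (λ g≡r → r≢g (sym g≡r))
        (λ g≡s → proper _ _ esp (trans (cong col (sym g≡s)) g~u))
        (onC g g∈D)
      D' : ShortCycle G
      D' = sq u w₁ g w₂ (eneq uw₁) (u≢outer out-g) (eneq uw₂) (eneq w₁g) w₁≢w₂ (≢-sym (eneq w₂g))
             uw₁ w₁g (esym w₂g) (esym uw₂)
      meet : MeetInPath1 G D D'
      meet = proj₂ D∈S1 D' (different D D' {u} {w₁} (inj₁ (inj₁ (refl , refl))) (path-avoids uw₁ w₁g) ,
                            u , onp , at₁ refl)
      only-u : ∀ t → OnCycle G D t → OnCycle G D' t → t ≡ u
      only-u t t∈D (inj₁ t≡u)                = t≡u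
      only-u t t∈D (inj₂ (inj₁ refl))        = ⊥-elim (path-avoids uw₁ w₁g t∈D)
      only-u t t∈D (inj₂ (inj₂ (inj₁ refl))) = ⊥-elim (g∉D t∈D)
      only-u t t∈D (inj₂ (inj₂ (inj₂ refl))) = ⊥-elim (path-avoids uw₂ w₂g t∈D)

    -- Positive surplus at two outer vertices g₁, g₂: one of them is the vertex
    -- opposite to u on D, or else u has three partners g₁, g₂, r.
    two-medium : ∀ {s₀ g₁ g₂} (V : Square D u s₀) → g₁ ≢ g₂ → Outer g₁ → Outer g₂ →
      2 ≤ cm u g₁ → 2 ≤ cm u g₂ → ⊥
    two-medium {g₁ = g₁} {g₂} V g₁≢g₂ out₁ out₂ 2≤₁ 2≤₂ with Square.r V ≟ g₁ | Square.r V ≟ g₂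
    ... | yes refl | _        = meets-only-u V g₁≢g₂ out₁ out₂ 2≤₂
    ... | no  _    | yes refl = meets-only-u V (≢-sym g₁≢g₂) out₂ out₁ 2≤₁
    ... | no r≢g₁  | no r≢g₂  = no-2-2-2-common (u≢outer out₁) (u≢outer out₂) (Square.pr V)
                                  g₁≢g₂ (≢-sym r≢g₁) (≢-sym r≢g₂) 2≤₁ 2≤₂ (opposite-cm V)

    impossible : ⊥
    impossible with squareThrough D u∈D | large-or-two outer-surplus two-outer-surplus
    ... | _ , V | inj₁ (g , 2≤) with surplus-info {g = g} 2≤
    ...   | out , 3≤ = one-large V out 3≤
    impossible | _ , V | inj₂ (g₁ , g₂ , g₁≢g₂ , 1≤₁ , 1≤₂)
      with surplus-info {g = g₁} 1≤₁ | surplus-info {g = g₂} 1≤₂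
    ...   | out₁ , 2≤₁ | out₂ , 2≤₂ = two-medium V g₁≢g₂ out₁ out₂ 2≤₁ 2≤₂

module Defect4Graph (G : Graph) (col : Fin (Graph.n G) → Bool)
                    (proper : ∀ u v → Edge G u v → col u ≢ col v)
                    (e : ℕ) (3≤e : 3 ≤ e) (max-deg : ∀ v → degree G v ≤ suc e)
                    (diam : ∀ u v → DistLe G u v 3)
                    (order : Graph.n G + 4 ≡ halfMoore e + halfMoore e) where
  open BipartiteGraph G col proper
  open ThetaFacts G col proper

  -- A branch vertex v lies on a theta graph θ, whose tip and middle have
  -- excess ≥ 2; this makes the graph (e + 1)-regular with all excesses ≤ 2.
  -- Then v is not a middle of θ (middles are not branch vertices) and, as
  -- a tip of θ, v has no neighbour on a cycle of S₁.
  branch-not-adjacent-to-Γ₁ : ∀ v u → BranchVertexΓ2 G v → VertexOfΓ1 G u → ¬ Edge G v u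
  branch-not-adjacent-to-Γ₁ v u branch (D , D∈S1 , u∈D) vu with theta-at-branch branch
  ... | θ , v-on-θ = oneOf4-elim at-tip at-other-tip at-middle at-middle₂ v-on-θ
    where
    open Theta θ
    regularity : ∀ t → Ex t ≤ 2 × deg t ≡ suc e
    regularity = PathCounting.regular G col proper e max-deg diam 3≤e order
                   (proper _ _ xm₁) (tip-excess θ) (middle-excess θ)
    open SmallExcess G col proper (proj₁ ∘ regularity)
    open RegularSmallExcess G col proper (proj₁ ∘ regularity) (suc e) (proj₂ ∘ regularity) diam
    at-tip : v ≡ x → ⊥
    at-tip v≡x = Tip.impossible θ (subst (λ t → Edge G t u) v≡x vu) D∈S1 u∈D
    at-other-tip : v ≡ z → ⊥
    at-other-tip v≡z = Tip.impossible (swap-tips θ) (subst (λ t → Edge G t u) v≡z vu) D∈S1 u∈D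
    at-middle : v ≡ m₁ → ⊥
    at-middle v≡m₁ = Middle.not-branch θ (subst (BranchVertexΓ2 G) v≡m₁ branch)
    at-middle₂ : v ≡ m₂ → ⊥
    at-middle₂ v≡m₂ = Middle.not-branch (swap₁₂ θ) (subst (BranchVertexΓ2 G) v≡m₂ branch)

moore-3 : ∀ e → MooreBip (suc e) 3 ≡ halfMoore e + halfMoore e
moore-3 e rewrite *-identityʳ e = cong (halfMoore e +_) (+-identityʳ (halfMoore e))

mainTheorem12 : (G : Graph) (d : ℕ) → 4 ≤ d → BipartiteDDε G d 3 4 →
    ∀ (v u : Fin (Graph.n G)) → BranchVertexΓ2 G v → VertexOfΓ1 G u → ¬ Edge G v u
mainTheorem12 G (suc e) (s≤s 3≤e) ((col , proper) , (max-deg , _) , (diam , _) , order) =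
  Defect4Graph.branch-not-adjacent-to-Γ₁ G col proper e 3≤e max-deg diam (trans order (moore-3 e))
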